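{- Let $d$ be a positive integer and $n\geq0$ an integer. Then $\Psi(\mathcal{P}_d(\mathbf{n}))=I(n\mathbf{e}(1))$.
   Context: Let $\underline n=\{1,\dots,n\}$, $\underline n'=\{1',\dots,n'\}$, $\mathbf n=\underline n\cup\underline n'$. $\mathcal{P}_d(\mathbf n)$ is the set of set partitions $\sigma$ of $\mathbf n$ into nonempty blocks such that every block $B$ satisfies $d\mid |B\cap\underline n|-|B\cap\underline n'|$ (the $d$-tonal partition monoid). The $d$-signature is $\Psi(\sigma)=(v_1,\dots,v_d)\in\mathbb{Z}_{\geq0}^d$, where $v_i$ is the number of blocks $B$ of $\sigma$ with $B\cap\underline n\neq\varnothing$, $B\cap\underline n'\neq\varnothing$ and $d\mid |B\cap\underline n|-i$. $\Lambda_d=\mathbb{Z}_{\geq0}^d$ with basis $\mathbf{e}(1),\dots,\mathbf{e}(d)$; $X_d=\{\mathbf{e}(k)-\mathbf{e}(i)-\mathbf{e}(j): i,j,k\in\{1,\dots,d\},\ d\mid k-i-j\}$; for $\mathbf{v},\mathbf{w}\in\Lambda_d$, $\mathbf{v}\lessdot\mathbf{w}$ iff $\mathbf{v}-\mathbf{w}\in X_d$; $\prec$ is the transitive closure of $\lessdot$ on $\Lambda_d$; $I(\mathbf v)=\{\mathbf v\}\cup\{\mathbf w\in\Lambda_d:\mathbf w\prec\mathbf v\}$. -}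

module Defs where

open import Data.Nat using (ℕ; zero; suc; _≤_)
open import Data.Integer using (ℤ; +_; _-_; _+_)
open import Data.Integer.Divisibility using (_∣_)
open import Data.Fin using (Fin; toℕ; _≟_)
open import Data.List using (List; length; filter; allFin)
open import Data.Vec using (Vec; tabulate; lookup)
open import Data.Sum using (_⊎_; inj₁; inj₂)
open import Data.Product using (Σ; _×_)
open import Relation.Binary.PropositionalEquality using (_≡_)
open import Relation.Nullary using (Dec; yes; no)
open import Relation.Nullary.Decidable using (_×-dec_)
open import Relation.Binary.Construct.Closure.Transitive using (TransClosure)
open import Data.Nat.Properties using (_≤?_)
open import Data.Nat.Divisibility using (_∣?_)
open import Data.Integer using (∣_∣)

-- The ground set 𝐧 = n ⊎ n' : inj₁ i is the point (toℕ i + 1) of n,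
-- inj₂ i is the point (toℕ i + 1)' of n'.
Ground : ℕ → Set
Ground n = Fin n ⊎ Fin n

-- A set partition of 𝐧 into m (nonempty) blocks is encoded by a SURJECTIVE
-- labelling f : 𝐧 → Fin m; the blocks are the fibres of f.
Surj : {A : Set} {m : ℕ} → (A → Fin m) → Set
Surj {A} {m} f = (b : Fin m) → Σ A (λ x → f x ≡ b)

upper : {n m : ℕ} → (Ground n → Fin m) → Fin m → ℕ
upper {n} f b = length (filter (λ i → f (inj₁ i) ≟ b) (allFin n))

lower : {n m : ℕ} → (Ground n → Fin m) → Fin m → ℕ
lower {n} f b = length (filter (λ i → f (inj₂ i) ≟ b) (allFin n))

IsTonal : (d : ℕ) {n m : ℕ} → (Ground n → Fin m) → Set
IsTonal d f = ∀ b → (+ d) ∣ (+ upper f b - + lower f b)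

-- v_i (i = toℕ k + 1): number of propagating blocks B with d ∣ |B ∩ n| - i
propCond : (d : ℕ) {n m : ℕ} → (Ground n → Fin m) → Fin d → Fin m → Set
propCond d f k b =
  (1 ≤ upper f b) × (1 ≤ lower f b) × ((+ d) ∣ (+ upper f b - + suc (toℕ k)))

propCond? : (d : ℕ) {n m : ℕ} (f : Ground n → Fin m) (k : Fin d) (b : Fin m) →
            Dec (propCond d f k b)
propCond? d f k b =
  (1 ≤? upper f b) ×-dec ((1 ≤? lower f b) ×-dec (d ∣? ∣ + upper f b - + suc (toℕ k) ∣))

Ψ : (d : ℕ) {n m : ℕ} → (Ground n → Fin m) → Vec ℕ d
Ψ d {m = m} f = tabulate (λ k → length (filter (propCond? d f k) (allFin m)))

-- Λ_d = ℕ^d, basis vector e(k) (k = toℕ k' + 1) as an integer vector entry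
δ : {d : ℕ} → Fin d → Fin d → ℤ
δ k l with k ≟ l
... | yes _ = + 1
... | no _  = + 0

_⋖_ : {d : ℕ} → Vec ℕ d → Vec ℕ d → Set
_⋖_ {d} v w = Σ (Fin d) λ i → Σ (Fin d) λ j → Σ (Fin d) λ k →
  ((+ d) ∣ (+ suc (toℕ k) - + suc (toℕ i) - + suc (toℕ j))) ×
  ((l : Fin d) → + lookup v l - + lookup w l ≡ δ k l - δ i l - δ j l)

_≺_ : {d : ℕ} → Vec ℕ d → Vec ℕ d → Set
w ≺ v = TransClosure _⋖_ w v

_∈I_ : {d : ℕ} → Vec ℕ d → Vec ℕ d → Set
w ∈I v = (w ≡ v) ⊎ (w ≺ v)

ne₁ : (d n : ℕ) → Vec ℕ d
ne₁ d n = tabulate λ k → f (toℕ k)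
  where f : ℕ → ℕ
        f zero = n
        f (suc _) = 0

InImageΨ : (d n : ℕ) → Vec ℕ d → Set
InImageΨ d n v = Σ ℕ λ m → Σ (Ground n → Fin m) λ f →
  Surj f × IsTonal d f × (Ψ d f ≡ v)

-- Both sets are cut out by one condition. Weight a vector by the labels of its entries,
-- weight v = Σ_i i·v_i; then v ∈ Ψ(𝒫_d(𝐧)) and v ∈ I(n e(1)) are each equivalent to
-- n = weight v + q·d for some q ≥ 0.
-- In a d-tonal partition a propagating block of type i meets n in i + q·d points, and every
-- other block meets n in a multiple of d; summing over the blocks gives the condition.
-- A step v ⋖ w merges types i and j into a type k ≡ i + j (mod d) with k ≤ d < i + j + d,
-- which lowers the weight by a multiple of d, and weight (n e(1)) = n.
-- Conversely, both families are closed under addition (juxtapose partitions, translate chains)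
-- and contain e(k) at n = k together with 0 at n = 0 and at n = d; these generate every
-- solution of the condition.

module Submission where

open import Defs
open import Data.Bool using (true; false; if_then_else_)
open import Data.Fin using (Fin; zero; suc; toℕ; _≟_; _↑ˡ_; _↑ʳ_; splitAt; join; inject₁; fromℕ; fromℕ<)
open import Data.Fin.Induction using (<-weakInduction)
open import Data.Fin.Properties
  using (toℕ<n; toℕ-injective; toℕ-inject₁; toℕ-fromℕ; toℕ-fromℕ<; ↑ˡ-injective; ↑ʳ-injective;
         splitAt-↑ˡ; splitAt-↑ʳ; join-splitAt)
open import Data.Integer using (+_; _⊖_; ∣_∣) renaming (_+_ to _+ℤ_; _-_ to _-ℤ_)
open import Data.Integer.Divisibility using () renaming (_∣_ to _∣ℤ_)
import Data.Integer.Properties as ℤ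
import Data.Integer.Tactic.RingSolver as ℤ-Solver
open import Data.List using (length; filter; allFin; tabulate)
open import Data.List.Properties using (filter-all; filter-none; length-tabulate)
open import Data.List.Relation.Unary.All using (universal)
open import Data.Nat as ℕ using (ℕ; zero; suc; _+_; _*_; _∸_; _≤_; _<_; z≤n; s≤s; NonZero; _%_; _/_)
open import Data.Nat.DivMod using (m≡m%n+[m/n]*n; m%n<n; [m+kn]%n≡m%n; m<n⇒m%n≡m)
open import Data.Nat.Divisibility using (divides; ∣⇒≤; _∣?_) renaming (_∣_ to _∣ℕ_)
open import Data.Nat.Properties hiding (_≟_)
open import Data.Nat.Tactic.RingSolver using (solve-∀)
open import Algebra.Properties.Semiring.Sum +-*-semiring
  using (sum-syntax; sum-cong-≗; sum-replicate-zero; ∑-distrib-+; ∑-comm; *-distribˡ-sum)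
open import Data.Product using (Σ; ∃-syntax; _×_; _,_)
open import Data.Sum as Sum using (_⊎_; inj₁; inj₂; [_,_]′)
open import Data.Vec as Vec using (Vec; []; _∷_; lookup; zipWith)
open import Data.Vec.Properties using (lookup∘tabulate; tabulate∘lookup; tabulate-cong; lookup-zipWith)
open import Function using (_∘_; _⇔_; mk⇔; Equivalence)
open import Level using (0ℓ)
open import Relation.Binary.Construct.Closure.Transitive using ([_]; _∷_; _++_)
open import Relation.Binary.PropositionalEquality
open import Relation.Nullary using (Dec; yes; no; does; ¬_; contradiction)
open import Relation.Nullary.Decidable using (_×-dec_; does-⇔; dec-false)
open import Relation.Unary using (Pred; Decidable)

open Equivalence using (to; from)
open ≡-Reasoning

𝟙[_] : {A : Set} → Dec A → ℕ
𝟙[ a? ] = if does a? then 1 else 0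

𝟙-⇔ : {A B : Set} → A ⇔ B → (a? : Dec A) (b? : Dec B) → 𝟙[ a? ] ≡ 𝟙[ b? ]
𝟙-⇔ A⇔B a? b? = cong (if_then 1 else 0) (does-⇔ A⇔B a? b?)

𝟙-no : {A : Set} (a? : Dec A) → ¬ A → 𝟙[ a? ] ≡ 0
𝟙-no a? ¬a rewrite dec-false a? ¬a = refl

∑-zero : ∀ {n} (f : Fin n → ℕ) → (∀ i → f i ≡ 0) → ∑[ i < n ] f i ≡ 0
∑-zero {n} f f≗0 = trans (sum-cong-≗ {n} {y = λ _ → 0} f≗0) (sum-replicate-zero n)

∑-δ : ∀ {n} (h : Fin n → ℕ) (k : Fin n) → ∑[ l < n ] (h l * 𝟙[ k ≟ l ]) ≡ h k
∑-δ {suc n} h zero = begin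
  h zero * 1 + ∑[ l < n ] (h (suc l) * 0)
    ≡⟨ cong₂ _+_ (*-identityʳ (h zero)) (∑-zero _ (*-zeroʳ ∘ h ∘ suc)) ⟩
  h zero + 0
    ≡⟨ +-identityʳ (h zero) ⟩
  h zero ∎
∑-δ {suc n} h (suc k) =
  trans (cong (_+ ∑[ l < n ] (h (suc l) * 𝟙[ k ≟ l ])) (*-zeroʳ (h zero))) (∑-δ (h ∘ suc) k)

∑-𝟙 : ∀ {n} (k : Fin n) → ∑[ l < n ] 𝟙[ k ≟ l ] ≡ 1
∑-𝟙 k = trans (sum-cong-≗ (λ l → sym (*-identityˡ 𝟙[ k ≟ l ]))) (∑-δ (λ _ → 1) k)

∑-1 : ∀ n → ∑[ i < n ] 1 ≡ n
∑-1 zero    = refl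
∑-1 (suc n) = cong suc (∑-1 n)

∑-split : ∀ m {n} (f : Fin (m + n) → ℕ) →
          ∑[ i < m + n ] f i ≡ ∑[ i < m ] f (i ↑ˡ n) + ∑[ j < n ] f (m ↑ʳ j)
∑-split zero    f = refl
∑-split (suc m) f = trans (cong (λ s → f zero + s) (∑-split m (f ∘ suc))) (sym (+-assoc (f zero) _ _))

length-filter-tabulate : ∀ {A : Set} {P : Pred A 0ℓ} (P? : Decidable P) {n} (g : Fin n → A) →
                         length (filter P? (tabulate g)) ≡ ∑[ i < n ] 𝟙[ P? (g i) ]
length-filter-tabulate P? {zero}  g = refl
length-filter-tabulate P? {suc n} g with does (P? (g zero))
... | true  = cong suc (length-filter-tabulate P? (g ∘ suc))
... | false = length-filter-tabulate P? (g ∘ suc)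

count-all : ∀ {n} {P : Pred (Fin n) 0ℓ} (P? : Decidable P) → (∀ i → P i) →
            length (filter P? (allFin n)) ≡ n
count-all {n} P? all = trans (cong length (filter-all P? (universal all (allFin n)))) (length-tabulate _)

count-none : ∀ {n} {P : Pred (Fin n) 0ℓ} (P? : Decidable P) → (∀ i → ¬ P i) →
             length (filter P? (allFin n)) ≡ 0
count-none {n} P? none = cong length (filter-none P? (universal none (allFin n)))

[+m]-[+n]≡[+o]-[+p]-[+q]⇔m+p+q≡n+o : ∀ m n o p q →
  (+ m -ℤ + n ≡ + o -ℤ + p -ℤ + q) ⇔ (m + p + q ≡ n + o)
[+m]-[+n]≡[+o]-[+p]-[+q]⇔m+p+q≡n+o m n o p q = mk⇔
  (λ eq → ℤ.+-injective (ℤ.i-j≡0⇒i≡j _ _ (begin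
    + (m + p + q) -ℤ + (n + o)                 ≡⟨ difference ⟩
    (+ m -ℤ + n) -ℤ (+ o -ℤ + p -ℤ + q)         ≡⟨ cong (_-ℤ (+ o -ℤ + p -ℤ + q)) eq ⟩
    (+ o -ℤ + p -ℤ + q) -ℤ (+ o -ℤ + p -ℤ + q)  ≡⟨ ℤ.+-inverseʳ (+ o -ℤ + p -ℤ + q) ⟩
    + 0                                       ∎)))
  (λ eq → ℤ.i-j≡0⇒i≡j _ _ (begin
    (+ m -ℤ + n) -ℤ (+ o -ℤ + p -ℤ + q)         ≡⟨ difference ⟨
    + (m + p + q) -ℤ + (n + o)                 ≡⟨ cong (λ x → + x -ℤ + (n + o)) eq ⟩
    + (n + o) -ℤ + (n + o)                     ≡⟨ ℤ.+-inverseʳ (+ (n + o)) ⟩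
    + 0                                       ∎))
  where
  regroup : ∀ x y z u w → (x +ℤ u +ℤ w) -ℤ (y +ℤ z) ≡ (x -ℤ y) -ℤ (z -ℤ u -ℤ w)
  regroup = ℤ-Solver.solve-∀
  difference : + (m + p + q) -ℤ + (n + o) ≡ (+ m -ℤ + n) -ℤ (+ o -ℤ + p -ℤ + q)
  difference = trans (cong₂ _-ℤ_ (trans (ℤ.pos-+ (m + p) q) (cong (_+ℤ + q) (ℤ.pos-+ m p))) (ℤ.pos-+ n o))
                     (regroup (+ m) (+ n) (+ o) (+ p) (+ q))

[+m+o]-[+n+o]≡[+m]-[+n] : ∀ m n o → + (m + o) -ℤ + (n + o) ≡ + m -ℤ + n
[+m+o]-[+n+o]≡[+m]-[+n] m n o = trans (cong₂ _-ℤ_ (ℤ.pos-+ m o) (ℤ.pos-+ n o)) (cancel (+ m) (+ n) (+ o))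
  where cancel : ∀ x y z → (x +ℤ z) -ℤ (y +ℤ z) ≡ x -ℤ y
        cancel = ℤ-Solver.solve-∀

infix 4 _≡_[mod_]
_≡_[mod_] : ℕ → ℕ → ℕ → Set
m ≡ n [mod d ] = (+ d) ∣ℤ (+ m -ℤ + n)

≡[mod]-sym : ∀ {d} m n → m ≡ n [mod d ] → n ≡ m [mod d ]
≡[mod]-sym {d} m n = subst (d ∣ℕ_) (begin
  ∣ + m -ℤ + n ∣ ≡⟨ cong ∣_∣ (ℤ.[+m]-[+n]≡m⊖n m n) ⟩
  ∣ m ⊖ n ∣      ≡⟨ ℤ.∣m⊖n∣≡∣n⊖m∣ m n ⟩
  ∣ n ⊖ m ∣      ≡⟨ cong ∣_∣ (ℤ.[+m]-[+n]≡m⊖n n m) ⟨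
  ∣ + n -ℤ + m ∣ ∎)

≡[mod]-merge⇔ : ∀ {d} k i j → (+ d) ∣ℤ (+ k -ℤ + i -ℤ + j) ⇔ k ≡ i + j [mod d ]
≡[mod]-merge⇔ {d} k i j = mk⇔ (subst (λ x → (+ d) ∣ℤ x) regroup) (subst (λ x → (+ d) ∣ℤ x) (sym regroup))
  where
  assoc : ∀ x y z → x -ℤ y -ℤ z ≡ x -ℤ (y +ℤ z)
  assoc = ℤ-Solver.solve-∀
  regroup : + k -ℤ + i -ℤ + j ≡ + k -ℤ + (i + j)
  regroup = trans (assoc (+ k) (+ i) (+ j)) (cong (λ x → + k -ℤ x) (sym (ℤ.pos-+ i j)))

infix 4 _≼[_]_
_≼[_]_ : ℕ → ℕ → ℕ → Set
m ≼[ d ] n = ∃[ q ] n ≡ m + q * d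

≼-reflexive : ∀ {d m n} → m ≡ n → m ≼[ d ] n
≼-reflexive {m = m} refl = 0 , sym (+-identityʳ m)

≼-trans : ∀ {d m n o} → m ≼[ d ] n → n ≼[ d ] o → m ≼[ d ] o
≼-trans {d} {m} (p , refl) (q , refl) = p + q , regroup m p q d
  where regroup : ∀ m p q d → m + p * d + q * d ≡ m + (p + q) * d
        regroup = solve-∀

≼-+ : ∀ {d m n o r} → m ≼[ d ] n → o ≼[ d ] r → m + o ≼[ d ] n + r
≼-+ {d} {m} {o = o} (p , refl) (q , refl) = p + q , regroup m p o q d
  where regroup : ∀ m p o q d → m + p * d + (o + q * d) ≡ m + o + (p + q) * d
        regroup = solve-∀

≼-cancelʳ : ∀ {d x y s t} → x + s ≡ y + t → t ≼[ d ] s → x ≼[ d ] y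
≼-cancelʳ {d} {x} {y} {t = t} eq (q , refl) = q , +-cancelʳ-≡ t y (x + q * d) (trans (sym eq) (regroup x t q d))
  where regroup : ∀ x t q d → x + (t + q * d) ≡ x + q * d + t
        regroup = solve-∀

∑-≼ : ∀ {d m} (f g : Fin m → ℕ) → (∀ b → f b ≼[ d ] g b) → ∑[ b < m ] f b ≼[ d ] ∑[ b < m ] g b
∑-≼ {m = zero}  f g f≼g = ≼-reflexive refl
∑-≼ {m = suc m} f g f≼g = ≼-+ (f≼g zero) (∑-≼ (f ∘ suc) (g ∘ suc) (f≼g ∘ suc))

≼⇒≡[mod] : ∀ {d m n} → m ≼[ d ] n → m ≡ n [mod d ]
≼⇒≡[mod] {d} {m} (q , refl) = divides q (begin
  ∣ + m -ℤ + (m + q * d) ∣ ≡⟨ cong ∣_∣ (ℤ.[+m]-[+n]≡m⊖n m (m + q * d)) ⟩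
  ∣ m ⊖ (m + q * d) ∣      ≡⟨ ℤ.∣⊖∣-≤ (m≤m+n m (q * d)) ⟩
  m + q * d ∸ m            ≡⟨ m+n∸m≡n m (q * d) ⟩
  q * d                    ∎)

-- The bound excludes n < m, where 0 < m ∸ n < d cannot be a multiple of d.
≡[mod]⇒≼ : ∀ {d m n} .{{_ : NonZero d}} → m ≡ n [mod d ] → m < n + d → m ≼[ d ] n
≡[mod]⇒≼ {d} {m} {n} d∣m-n m<n+d with m ≤? n
... | yes m≤n
  with divides q n∸m≡q*d ← subst (d ∣ℕ_) (trans (cong ∣_∣ (ℤ.[+m]-[+n]≡m⊖n m n)) (ℤ.∣⊖∣-≤ m≤n))
                                         d∣m-n =
  q , trans (sym (m+[n∸m]≡n m≤n)) (cong (λ r → m + r) n∸m≡q*d)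
... | no m≰n = contradiction (∣⇒≤ {{ℕ.>-nonZero (m<n⇒0<n∸m n<m)}} d∣m∸n) (<⇒≱ (m<n+o⇒m∸n<o m n m<n+d))
  where
  n<m : n < m
  n<m = ≰⇒> m≰n
  d∣m∸n : d ∣ℕ m ∸ n
  d∣m∸n = subst (d ∣ℕ_) (trans (cong ∣_∣ (ℤ.[+m]-[+n]≡m⊖n m n))
                                (trans (ℤ.∣m⊖n∣≡∣n⊖m∣ m n) (ℤ.∣⊖∣-< n<m))) d∣m-n

lookup-extensionality : ∀ {A : Set} {d} {v w : Vec A d} → (∀ l → lookup v l ≡ lookup w l) → v ≡ w
lookup-extensionality {v = v} {w} v≗w =
  trans (sym (tabulate∘lookup v)) (trans (tabulate-cong v≗w) (tabulate∘lookup w))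

infixl 6 _⊕_
_⊕_ : ∀ {d} → Vec ℕ d → Vec ℕ d → Vec ℕ d
_⊕_ = zipWith _+_

0⃗ : ∀ {d} → Vec ℕ d
0⃗ = Vec.tabulate (λ _ → 0)

e : ∀ {d} → Fin d → Vec ℕ d
e k = Vec.tabulate (λ l → 𝟙[ k ≟ l ])

lookup-⊕ : ∀ {d} (v w : Vec ℕ d) l → lookup (v ⊕ w) l ≡ lookup v l + lookup w l
lookup-⊕ v w l = lookup-zipWith _+_ l v w

lookup-0⃗ : ∀ {d} (l : Fin d) → lookup 0⃗ l ≡ 0
lookup-0⃗ = lookup∘tabulate (λ _ → 0)

lookup-⊕-e : ∀ {d} (v : Vec ℕ d) k l → lookup (v ⊕ e k) l ≡ lookup v l + 𝟙[ k ≟ l ]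
lookup-⊕-e v k l =
  trans (lookup-⊕ v (e k) l) (cong (λ x → lookup v l + x) (lookup∘tabulate (λ l → 𝟙[ k ≟ l ]) l))

⊕-identityʳ : ∀ {d} (v : Vec ℕ d) → v ⊕ 0⃗ ≡ v
⊕-identityʳ v = lookup-extensionality λ l →
  trans (lookup-⊕ v 0⃗ l) (trans (cong (λ r → lookup v l + r) (lookup-0⃗ l)) (+-identityʳ (lookup v l)))

⊕-comm : ∀ {d} (v w : Vec ℕ d) → v ⊕ w ≡ w ⊕ v
⊕-comm v w = lookup-extensionality λ l →
  trans (lookup-⊕ v w l) (trans (+-comm (lookup v l) (lookup w l)) (sym (lookup-⊕ w v l)))

⊕-assoc : ∀ {d} (u v w : Vec ℕ d) → u ⊕ v ⊕ w ≡ u ⊕ (v ⊕ w)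
⊕-assoc u v w = lookup-extensionality λ l → begin
  lookup (u ⊕ v ⊕ w) l
    ≡⟨ trans (lookup-⊕ (u ⊕ v) w l) (cong (_+ lookup w l) (lookup-⊕ u v l)) ⟩
  lookup u l + lookup v l + lookup w l
    ≡⟨ +-assoc (lookup u l) (lookup v l) (lookup w l) ⟩
  lookup u l + (lookup v l + lookup w l)
    ≡⟨ trans (lookup-⊕ u (v ⊕ w) l) (cong (λ r → lookup u l + r) (lookup-⊕ v w l)) ⟨
  lookup (u ⊕ (v ⊕ w)) l ∎

size : ∀ {d} → Vec ℕ d → ℕ
size {d} v = ∑[ l < d ] lookup v l

weight : ∀ {d} → Vec ℕ d → ℕ
weight {d} v = ∑[ l < d ] (suc (toℕ l) * lookup v l)

weight-⊕ : ∀ {d} (v w : Vec ℕ d) → weight (v ⊕ w) ≡ weight v + weight w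
weight-⊕ v w = trans (sum-cong-≗ λ l → trans (cong (suc (toℕ l) *_) (lookup-⊕ v w l))
                                            (*-distribˡ-+ (suc (toℕ l)) (lookup v l) (lookup w l)))
                     (∑-distrib-+ (λ l → suc (toℕ l) * lookup v l) (λ l → suc (toℕ l) * lookup w l))

weight-⊕-e : ∀ {d} (v : Vec ℕ d) k → weight (v ⊕ e k) ≡ weight v + suc (toℕ k)
weight-⊕-e v k = trans (weight-⊕ v (e k)) (cong (λ x → weight v + x)
  (trans (sum-cong-≗ λ l → cong (suc (toℕ l) *_) (lookup∘tabulate (λ l → 𝟙[ k ≟ l ]) l))
         (∑-δ (suc ∘ toℕ) k)))

weight-0⃗ : ∀ {d} → weight (0⃗ {d}) ≡ 0
weight-0⃗ {d} = ∑-zero {d} (λ l → suc (toℕ l) * lookup 0⃗ l)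
                          (λ l → trans (cong (suc (toℕ l) *_) (lookup-0⃗ l)) (*-zeroʳ (suc (toℕ l))))

size≡0⇒≡0⃗ : ∀ {d} (v : Vec ℕ d) → size v ≡ 0 → v ≡ 0⃗
size≡0⇒≡0⃗ []         _  = refl
size≡0⇒≡0⃗ (zero ∷ v) eq = cong (0 ∷_) (size≡0⇒≡0⃗ v eq)

peel : ∀ {d c} (v : Vec ℕ d) → size v ≡ suc c → ∃[ k ] ∃[ w ] v ≡ w ⊕ e k × size w ≡ c
peel (suc x ∷ v) eq = zero , x ∷ v , cong₂ _∷_ (+-comm 1 x) (sym (⊕-identityʳ v)) , suc-injective eq
peel (zero ∷ v)  eq with k , w , v≡w⊕e , size≡ ← peel v eq = suc k , 0 ∷ w , cong (0 ∷_) v≡w⊕e , size≡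

module Generation {d} (P : ℕ → Vec ℕ d → Set)
                  (P-0⃗ : P 0 0⃗)
                  (P-⊕ : ∀ {m n v w} → P m v → P n w → P (m + n) (v ⊕ w))
                  (P-e : ∀ k → P (suc (toℕ k)) (e k))
                  (P-period : P d 0⃗)
                  where

  private
    P-weight : ∀ c v → size v ≡ c → P (weight v) v
    P-weight zero v eq =
      subst (λ v → P (weight v) v) (sym (size≡0⇒≡0⃗ v eq)) (subst (λ n → P n 0⃗) (sym (weight-0⃗ {d})) P-0⃗)
    P-weight (suc c) v eq with k , w , refl , size≡ ← peel v eq =
      subst (λ n → P n (w ⊕ e k)) (sym (weight-⊕-e w k)) (P-⊕ (P-weight c w size≡) (P-e k))

    P-multiple : ∀ q → P (q * d) 0⃗
    P-multiple zero    = P-0⃗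
    P-multiple (suc q) = subst (P (d + q * d)) (⊕-identityʳ 0⃗) (P-⊕ P-period (P-multiple q))

  weight≼⇒P : ∀ {n v} → weight v ≼[ d ] n → P n v
  weight≼⇒P {v = v} (q , refl) = subst (P _) (⊕-identityʳ v) (P-⊕ (P-weight _ v refl) (P-multiple q))

δ≡𝟙 : ∀ {d} (k l : Fin d) → δ k l ≡ + 𝟙[ k ≟ l ]
δ≡𝟙 k l with k ≟ l
... | yes _ = refl
... | no _  = refl

⋖-equation⇔ : ∀ {d} {v w : Vec ℕ d} (i j k : Fin d) →
              (∀ l → + lookup v l -ℤ + lookup w l ≡ δ k l -ℤ δ i l -ℤ δ j l) ⇔ (v ⊕ e i ⊕ e j ≡ w ⊕ e k)
⋖-equation⇔ {v = v} {w} i j k = mk⇔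
  (λ eqs → lookup-extensionality λ l → begin
     lookup (v ⊕ e i ⊕ e j) l             ≡⟨ lhs l ⟩
     lookup v l + 𝟙[ i ≟ l ] + 𝟙[ j ≟ l ] ≡⟨ to (pointwise l) (trans (eqs l) (δs l)) ⟩
     lookup w l + 𝟙[ k ≟ l ]             ≡⟨ lookup-⊕-e w k l ⟨
     lookup (w ⊕ e k) l                   ∎)
  (λ eq l → trans (from (pointwise l) (trans (sym (lhs l)) (trans (cong (λ x → lookup x l) eq) (lookup-⊕-e w k l))))
                  (sym (δs l)))
  where
  pointwise : ∀ l → _ ⇔ _
  pointwise l = [+m]-[+n]≡[+o]-[+p]-[+q]⇔m+p+q≡n+o (lookup v l) (lookup w l) 𝟙[ k ≟ l ] 𝟙[ i ≟ l ] 𝟙[ j ≟ l ]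
  δs : ∀ l → δ k l -ℤ δ i l -ℤ δ j l ≡ + 𝟙[ k ≟ l ] -ℤ + 𝟙[ i ≟ l ] -ℤ + 𝟙[ j ≟ l ]
  δs l = cong₂ _-ℤ_ (cong₂ _-ℤ_ (δ≡𝟙 k l) (δ≡𝟙 i l)) (δ≡𝟙 j l)
  lhs : ∀ l → lookup (v ⊕ e i ⊕ e j) l ≡ lookup v l + 𝟙[ i ≟ l ] + 𝟙[ j ≟ l ]
  lhs l = trans (lookup-⊕-e (v ⊕ e i) j l) (cong (_+ 𝟙[ j ≟ l ]) (lookup-⊕-e v i l))

⋖-intro : ∀ {d} {v w : Vec ℕ d} (i j k : Fin d) → suc (toℕ k) ≼[ d ] suc (toℕ i) + suc (toℕ j) →
          v ⊕ e i ⊕ e j ≡ w ⊕ e k → v ⋖ w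
⋖-intro i j k k≼i+j eq =
  i , j , k , from (≡[mod]-merge⇔ (suc (toℕ k)) (suc (toℕ i)) (suc (toℕ j))) (≼⇒≡[mod] k≼i+j) ,
  from (⋖-equation⇔ i j k) eq

⋖⇒weight≼ : ∀ {d} .{{_ : NonZero d}} {v w : Vec ℕ d} → v ⋖ w → weight v ≼[ d ] weight w
⋖⇒weight≼ {d} {v} {w} (i , j , k , k≡i+j , eqs) = ≼-cancelʳ balance k≼i+j
  where
  balance : weight v + (suc (toℕ i) + suc (toℕ j)) ≡ weight w + suc (toℕ k)
  balance = begin
    weight v + (suc (toℕ i) + suc (toℕ j)) ≡⟨ +-assoc (weight v) _ _ ⟨
    weight v + suc (toℕ i) + suc (toℕ j)
      ≡⟨ trans (weight-⊕-e (v ⊕ e i) j) (cong (_+ suc (toℕ j)) (weight-⊕-e v i)) ⟨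
    weight (v ⊕ e i ⊕ e j)                  ≡⟨ cong weight (to (⋖-equation⇔ {v = v} {w} i j k) eqs) ⟩
    weight (w ⊕ e k)                        ≡⟨ weight-⊕-e w k ⟩
    weight w + suc (toℕ k)                 ∎
  k≼i+j : suc (toℕ k) ≼[ d ] suc (toℕ i) + suc (toℕ j)
  k≼i+j = ≡[mod]⇒≼ (to (≡[mod]-merge⇔ (suc (toℕ k)) (suc (toℕ i)) (suc (toℕ j))) k≡i+j)
                   (s≤s (≤-trans (toℕ<n k) (m≤n+m d (toℕ i + suc (toℕ j)))))

≺⇒weight≼ : ∀ {d} .{{_ : NonZero d}} {v w : Vec ℕ d} → v ≺ w → weight v ≼[ d ] weight w
≺⇒weight≼ {v = v} {w} [ v⋖w ]           = ⋖⇒weight≼ {v = v} {w} v⋖w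
≺⇒weight≼ {v = v} (_∷_ {y = u} v⋖u u≺w) = ≼-trans (⋖⇒weight≼ {v = v} {u} v⋖u) (≺⇒weight≼ u≺w)

-- ne₁ (suc d) n reduces to n ∷ 0⃗.
weight-ne₁ : ∀ d n → weight (ne₁ (suc d) n) ≡ n
weight-ne₁ d n = trans (cong₂ _+_ (*-identityˡ n) (∑-zero {d} (λ l → suc (suc (toℕ l)) * lookup 0⃗ l) vanish))
                       (+-identityʳ n)
  where vanish : ∀ l → suc (suc (toℕ l)) * lookup 0⃗ l ≡ 0
        vanish l = trans (cong (suc (suc (toℕ l)) *_) (lookup-0⃗ l)) (*-zeroʳ (suc (suc (toℕ l))))

ne₁-+ : ∀ d m n → ne₁ (suc d) (m + n) ≡ ne₁ (suc d) m ⊕ ne₁ (suc d) n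
ne₁-+ d m n = cong (m + n ∷_) (sym (⊕-identityʳ 0⃗))

∈I⇒weight≼ : ∀ {d n} {v : Vec ℕ (suc d)} → v ∈I ne₁ (suc d) n → weight v ≼[ suc d ] n
∈I⇒weight≼ {d} {n} (inj₁ refl)   = ≼-reflexive (weight-ne₁ d n)
∈I⇒weight≼ {d} {n} (inj₂ v≺ne₁) = subst (λ x → _ ≼[ suc d ] x) (weight-ne₁ d n) (≺⇒weight≼ v≺ne₁)

⋖-⊕ʳ : ∀ {d} (u v w : Vec ℕ d) → v ⋖ w → (v ⊕ u) ⋖ (w ⊕ u)
⋖-⊕ʳ u v w (i , j , k , k≡i+j , eqs) = i , j , k , k≡i+j , λ l → begin
  + lookup (v ⊕ u) l -ℤ + lookup (w ⊕ u) l
    ≡⟨ cong₂ (λ x y → + x -ℤ + y) (lookup-⊕ v u l) (lookup-⊕ w u l) ⟩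
  + (lookup v l + lookup u l) -ℤ + (lookup w l + lookup u l)
    ≡⟨ [+m+o]-[+n+o]≡[+m]-[+n] (lookup v l) (lookup w l) (lookup u l) ⟩
  + lookup v l -ℤ + lookup w l
    ≡⟨ eqs l ⟩
  δ k l -ℤ δ i l -ℤ δ j l ∎

⋖-⊕ˡ : ∀ {d} (u v w : Vec ℕ d) → v ⋖ w → (u ⊕ v) ⋖ (u ⊕ w)
⋖-⊕ˡ u v w v⋖w = subst₂ _⋖_ (⊕-comm v u) (⊕-comm w u) (⋖-⊕ʳ u v w v⋖w)

∈I-trans : ∀ {d} {u v w : Vec ℕ d} → u ∈I v → v ∈I w → u ∈I w
∈I-trans (inj₁ refl) v∈Iw        = v∈Iw
∈I-trans (inj₂ u≺v)  (inj₁ refl) = inj₂ u≺v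
∈I-trans (inj₂ u≺v)  (inj₂ v≺w)  = inj₂ (u≺v ++ v≺w)

⋖-∈I : ∀ {d} {u v w : Vec ℕ d} → u ⋖ v → v ∈I w → u ∈I w
⋖-∈I u⋖v = ∈I-trans (inj₂ [ u⋖v ])

∈I-map : ∀ {d} (f : Vec ℕ d → Vec ℕ d) → (∀ v w → v ⋖ w → f v ⋖ f w) →
         ∀ {v w} → v ∈I w → f v ∈I f w
∈I-map f f-mono (inj₁ refl) = inj₁ refl
∈I-map f f-mono (inj₂ v≺w)  = inj₂ (≺-map v≺w)
  where ≺-map : ∀ {v w} → v ≺ w → f v ≺ f w
        ≺-map {v} {w} [ v⋖w ]           = [ f-mono v w v⋖w ]
        ≺-map {v} (_∷_ {y = u} v⋖u u≺w) = f-mono v u v⋖u ∷ ≺-map u≺w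

∈I-⊕ : ∀ {d} {v w a b : Vec ℕ d} → v ∈I a → w ∈I b → (v ⊕ w) ∈I (a ⊕ b)
∈I-⊕ {w = w} {a} v∈Ia w∈Ib = ∈I-trans (∈I-map (_⊕ w) (⋖-⊕ʳ w) v∈Ia) (∈I-map (a ⊕_) (⋖-⊕ˡ a) w∈Ib)

∈I-ne₁-⊕ : ∀ {d m n} {v w : Vec ℕ (suc d)} →
           v ∈I ne₁ (suc d) m → w ∈I ne₁ (suc d) n → (v ⊕ w) ∈I ne₁ (suc d) (m + n)
∈I-ne₁-⊕ {d} {m} {n} {v} {w} v∈I w∈I = subst (λ x → (v ⊕ w) ∈I x) (sym (ne₁-+ d m n)) (∈I-⊕ v∈I w∈I)

-- e(k+1) ⋖ e(k) + e(1).
e-∈I : ∀ {d} (k : Fin (suc d)) → e k ∈I ne₁ (suc d) (suc (toℕ k))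
e-∈I {d} = <-weakInduction (λ k → e k ∈I ne₁ (suc d) (suc (toℕ k))) (inj₁ refl) step
  where
  step : ∀ t → e (inject₁ t) ∈I ne₁ (suc d) (suc (toℕ (inject₁ t))) →
               e (suc t) ∈I ne₁ (suc d) (suc (suc (toℕ t)))
  step t ih = ⋖-∈I (⋖-intro (inject₁ t) zero (suc t) (≼-reflexive (sym sizes)) regroup)
                   (subst (λ x → (e (inject₁ t) ⊕ e zero) ∈I ne₁ (suc d) x) sizes (∈I-ne₁-⊕ ih e-zero-∈I))
    where
    e-zero-∈I : e zero ∈I ne₁ (suc d) 1
    e-zero-∈I = inj₁ refl
    sizes : suc (toℕ (inject₁ t)) + 1 ≡ suc (suc (toℕ t))
    sizes = trans (+-comm (suc (toℕ (inject₁ t))) 1) (cong (λ x → suc (suc x)) (toℕ-inject₁ t))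
    regroup : e (suc t) ⊕ e (inject₁ t) ⊕ e zero ≡ e (inject₁ t) ⊕ e zero ⊕ e (suc t)
    regroup = trans (⊕-assoc (e (suc t)) (e (inject₁ t)) (e zero)) (⊕-comm (e (suc t)) (e (inject₁ t) ⊕ e zero))

-- 0⃗ ⋖ e(d), since −e(d) = e(1) − e(1) − e(d) lies in X_d.
0⃗-∈I : ∀ {d} → 0⃗ ∈I ne₁ (suc d) (suc d)
0⃗-∈I {d} = ⋖-∈I (⋖-intro {w = e last} zero last zero (1 , cong suc last-size) regroup)
                 (subst (λ x → e last ∈I ne₁ (suc d) x) (cong suc (toℕ-fromℕ d)) (e-∈I last))
  where
  last : Fin (suc d)
  last = fromℕ d
  last-size : suc (toℕ last) ≡ 1 * suc d
  last-size = trans (cong suc (toℕ-fromℕ d)) (sym (*-identityˡ (suc d)))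
  regroup : 0⃗ ⊕ e zero ⊕ e last ≡ e last ⊕ e zero
  regroup = trans (cong (_⊕ e last) (trans (⊕-comm 0⃗ (e zero)) (⊕-identityʳ (e zero)))) (⊕-comm (e zero) (e last))

weight≼⇒∈I : ∀ {d n} {v : Vec ℕ (suc d)} → weight v ≼[ suc d ] n → v ∈I ne₁ (suc d) n
weight≼⇒∈I {d} = Generation.weight≼⇒P (λ n v → v ∈I ne₁ (suc d) n) (inj₁ refl) ∈I-ne₁-⊕ e-∈I 0⃗-∈I

Propagating : (d U L : ℕ) → Fin d → Set
Propagating d U L k = (1 ≤ U) × (1 ≤ L) × (U ≡ suc (toℕ k) [mod d ])

-- Written so that propCond? d f k b is definitionally propagating? d (upper f b) (lower f b) k.
propagating? : ∀ d U L k → Dec (Propagating d U L k)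
propagating? d U L k = (1 ≤? U) ×-dec ((1 ≤? L) ×-dec (d ∣? ∣ + U -ℤ + suc (toℕ k) ∣))

propagating⇔ : ∀ {d} .{{_ : NonZero d}} u l (k : Fin d) → Propagating d (suc u) (suc l) k ⇔ toℕ k ≡ u % d
propagating⇔ {d} u l k = mk⇔
  (λ (_ , _ , u≡k) → type (≡[mod]⇒≼ (≡[mod]-sym (suc u) (suc (toℕ k)) u≡k)
                                     (s≤s (≤-trans (toℕ<n k) (m≤n+m d u)))))
  (λ k≡u%d → s≤s z≤n , s≤s z≤n , ≡[mod]-sym (suc (toℕ k)) (suc u)
     (≼⇒≡[mod] (u / d , cong suc (trans (m≡m%n+[m/n]*n u d) (cong (_+ u / d * d) (sym k≡u%d))))))
  where
  type : suc (toℕ k) ≼[ d ] suc u → toℕ k ≡ u % d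
  type (q , eq) = begin
    toℕ k               ≡⟨ m<n⇒m%n≡m (toℕ<n k) ⟨
    toℕ k % d           ≡⟨ [m+kn]%n≡m%n (toℕ k) q d ⟨
    (toℕ k + q * d) % d ≡⟨ cong (_% d) (suc-injective eq) ⟨
    u % d               ∎

blockWeight : (d U L : ℕ) → ℕ
blockWeight d U L = ∑[ k < d ] (suc (toℕ k) * 𝟙[ propagating? d U L k ])

blockWeight-nonpropagating : ∀ d U L → (∀ k → ¬ Propagating d U L k) → blockWeight d U L ≡ 0
blockWeight-nonpropagating d U L none = ∑-zero (λ k → suc (toℕ k) * 𝟙[ propagating? d U L k ]) λ k →
  trans (cong (suc (toℕ k) *_) (𝟙-no (propagating? d U L k) (none k))) (*-zeroʳ (suc (toℕ k)))

blockWeight-propagating : ∀ {d} .{{_ : NonZero d}} u l → blockWeight d (suc u) (suc l) ≡ suc (u % d)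
blockWeight-propagating {d} u l = begin
  blockWeight d (suc u) (suc l)
    ≡⟨ sum-cong-≗ (λ k → cong (suc (toℕ k) *_) (𝟙-⇔ (type⇔ k) (propagating? d (suc u) (suc l) k) (r ≟ k))) ⟩
  ∑[ k < d ] (suc (toℕ k) * 𝟙[ r ≟ k ])
    ≡⟨ ∑-δ (suc ∘ toℕ) r ⟩
  suc (toℕ r)
    ≡⟨ cong suc (toℕ-fromℕ< (m%n<n u d)) ⟩
  suc (u % d) ∎
  where
  r : Fin d
  r = fromℕ< (m%n<n u d)
  type⇔ : ∀ k → Propagating d (suc u) (suc l) k ⇔ r ≡ k
  type⇔ k = mk⇔ (λ p → toℕ-injective (trans (toℕ-fromℕ< (m%n<n u d)) (sym (to (propagating⇔ u l k) p))))
                (λ r≡k → from (propagating⇔ u l k) (trans (cong toℕ (sym r≡k)) (toℕ-fromℕ< (m%n<n u d))))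

blockWeight≼upper : ∀ {d} .{{_ : NonZero d}} U L → U ≡ L [mod d ] → blockWeight d U L ≼[ d ] U
blockWeight≼upper {d} zero    L       _   = ≼-reflexive (blockWeight-nonpropagating d 0 L λ { _ (() , _) })
blockWeight≼upper {d} (suc u) zero    U≡L =
  subst (_≼[ d ] suc u) (sym (blockWeight-nonpropagating d (suc u) 0 λ { _ (_ , () , _) }))
        (≡[mod]⇒≼ (≡[mod]-sym (suc u) 0 U≡L) (s≤s z≤n))
blockWeight≼upper {d} (suc u) (suc l) _   =
  subst (_≼[ d ] suc u) (sym (blockWeight-propagating u l)) (u / d , cong suc (m≡m%n+[m/n]*n u d))

Ψ-lookup : ∀ d {n m} (f : Ground n → Fin m) k → lookup (Ψ d f) k ≡ ∑[ b < m ] 𝟙[ propCond? d f k b ]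
Ψ-lookup d f k = trans (lookup∘tabulate _ k) (length-filter-tabulate (propCond? d f k) (λ b → b))

weight-Ψ : ∀ d {n m} (f : Ground n → Fin m) → weight (Ψ d f) ≡ ∑[ b < m ] blockWeight d (upper f b) (lower f b)
weight-Ψ d {m = m} f = begin
  ∑[ k < d ] (suc (toℕ k) * lookup (Ψ d f) k)
    ≡⟨ sum-cong-≗ (λ k → cong (suc (toℕ k) *_) (Ψ-lookup d f k)) ⟩
  ∑[ k < d ] (suc (toℕ k) * ∑[ b < m ] 𝟙[ propCond? d f k b ])
    ≡⟨ sum-cong-≗ (λ k → *-distribˡ-sum (suc (toℕ k)) (λ b → 𝟙[ propCond? d f k b ])) ⟩
  ∑[ k < d ] ∑[ b < m ] (suc (toℕ k) * 𝟙[ propCond? d f k b ])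
    ≡⟨ ∑-comm (λ k b → suc (toℕ k) * 𝟙[ propCond? d f k b ]) ⟩
  ∑[ b < m ] blockWeight d (upper f b) (lower f b) ∎

fibreSize : ∀ {n m} → (Fin n → Fin m) → Fin m → ℕ
fibreSize {n} g b = length (filter (λ i → g i ≟ b) (allFin n))

fibreSize≡∑ : ∀ {n m} (g : Fin n → Fin m) b → fibreSize g b ≡ ∑[ i < n ] 𝟙[ g i ≟ b ]
fibreSize≡∑ g b = length-filter-tabulate (λ i → g i ≟ b) (λ i → i)

∑-fibreSize : ∀ {n m} (g : Fin n → Fin m) → ∑[ b < m ] fibreSize g b ≡ n
∑-fibreSize {n} {m} g = begin
  ∑[ b < m ] fibreSize g b           ≡⟨ sum-cong-≗ (fibreSize≡∑ g) ⟩
  ∑[ b < m ] ∑[ i < n ] 𝟙[ g i ≟ b ] ≡⟨ ∑-comm (λ b i → 𝟙[ g i ≟ b ]) ⟩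
  ∑[ i < n ] ∑[ b < m ] 𝟙[ g i ≟ b ] ≡⟨ sum-cong-≗ (∑-𝟙 ∘ g) ⟩
  ∑[ i < n ] 1                       ≡⟨ ∑-1 n ⟩
  n                                  ∎

image⇒weight≼ : ∀ {d n} .{{_ : NonZero d}} {v : Vec ℕ d} → InImageΨ d n v → weight v ≼[ d ] n
image⇒weight≼ {d} (m , f , _ , tonal , refl) =
  subst₂ (_≼[ d ]_) (sym (weight-Ψ d f)) (∑-fibreSize (f ∘ inj₁))
         (∑-≼ _ _ λ b → blockWeight≼upper (upper f b) (lower f b) (tonal b))

↑ˡ≢↑ʳ : ∀ {m n} (i : Fin m) (j : Fin n) → ¬ (i ↑ˡ n ≡ m ↑ʳ j)
↑ˡ≢↑ʳ {m} {n} i j eq with trans (sym (splitAt-↑ˡ m i n)) (trans (cong (splitAt m) eq) (splitAt-↑ʳ m n j))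
... | ()

↑-elim : ∀ {m₁ m₂} {P : Fin (m₁ + m₂) → Set} →
         (∀ b → P (b ↑ˡ m₂)) → (∀ b → P (m₁ ↑ʳ b)) → ∀ b → P b
↑-elim {m₁} {m₂} {P} left right b = subst P (join-splitAt m₁ m₂ b) (elim (splitAt m₁ b))
  where
  elim : (c : Fin m₁ ⊎ Fin m₂) → P (join m₁ m₂ c)
  elim (inj₁ c) = left c
  elim (inj₂ c) = right c

module _ {n₁ n₂ m₁ m₂ : ℕ} where

  infixr 5 _⊕ᶠ_ _⊔_

  _⊕ᶠ_ : (Fin n₁ → Fin m₁) → (Fin n₂ → Fin m₂) → Fin (n₁ + n₂) → Fin (m₁ + m₂)
  (g₁ ⊕ᶠ g₂) i = join m₁ m₂ (Sum.map g₁ g₂ (splitAt n₁ i))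

  ⊕ᶠ-↑ˡ : ∀ g₁ g₂ i → (g₁ ⊕ᶠ g₂) (i ↑ˡ n₂) ≡ g₁ i ↑ˡ m₂
  ⊕ᶠ-↑ˡ g₁ g₂ i rewrite splitAt-↑ˡ n₁ i n₂ = refl

  ⊕ᶠ-↑ʳ : ∀ g₁ g₂ i → (g₁ ⊕ᶠ g₂) (n₁ ↑ʳ i) ≡ m₁ ↑ʳ g₂ i
  ⊕ᶠ-↑ʳ g₁ g₂ i rewrite splitAt-↑ʳ n₁ n₂ i = refl

  fibreSize-⊕ᶠ-↑ˡ : ∀ g₁ g₂ b → fibreSize (g₁ ⊕ᶠ g₂) (b ↑ˡ m₂) ≡ fibreSize g₁ b
  fibreSize-⊕ᶠ-↑ˡ g₁ g₂ b = begin
    fibreSize g (b ↑ˡ m₂)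
      ≡⟨ trans (fibreSize≡∑ g (b ↑ˡ m₂)) (∑-split n₁ (λ i → 𝟙[ g i ≟ b ↑ˡ m₂ ])) ⟩
    ∑[ i < n₁ ] 𝟙[ g (i ↑ˡ n₂) ≟ b ↑ˡ m₂ ] + ∑[ j < n₂ ] 𝟙[ g (n₁ ↑ʳ j) ≟ b ↑ˡ m₂ ]
      ≡⟨ cong₂ _+_ (sum-cong-≗ same) (∑-zero (λ j → 𝟙[ g (n₁ ↑ʳ j) ≟ b ↑ˡ m₂ ]) other) ⟩
    ∑[ i < n₁ ] 𝟙[ g₁ i ≟ b ] + 0
      ≡⟨ trans (+-identityʳ (∑[ i < n₁ ] 𝟙[ g₁ i ≟ b ])) (sym (fibreSize≡∑ g₁ b)) ⟩
    fibreSize g₁ b ∎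
    where
    g = g₁ ⊕ᶠ g₂
    same : ∀ i → 𝟙[ g (i ↑ˡ n₂) ≟ b ↑ˡ m₂ ] ≡ 𝟙[ g₁ i ≟ b ]
    same i = 𝟙-⇔ (mk⇔ (↑ˡ-injective m₂ (g₁ i) b ∘ trans (sym (⊕ᶠ-↑ˡ g₁ g₂ i)))
                      (trans (⊕ᶠ-↑ˡ g₁ g₂ i) ∘ cong (_↑ˡ m₂)))
                 (g (i ↑ˡ n₂) ≟ b ↑ˡ m₂) (g₁ i ≟ b)
    other : ∀ j → 𝟙[ g (n₁ ↑ʳ j) ≟ b ↑ˡ m₂ ] ≡ 0
    other j = 𝟙-no (g (n₁ ↑ʳ j) ≟ b ↑ˡ m₂) (↑ˡ≢↑ʳ b (g₂ j) ∘ sym ∘ trans (sym (⊕ᶠ-↑ʳ g₁ g₂ j)))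

  fibreSize-⊕ᶠ-↑ʳ : ∀ g₁ g₂ b → fibreSize (g₁ ⊕ᶠ g₂) (m₁ ↑ʳ b) ≡ fibreSize g₂ b
  fibreSize-⊕ᶠ-↑ʳ g₁ g₂ b = begin
    fibreSize g (m₁ ↑ʳ b)
      ≡⟨ trans (fibreSize≡∑ g (m₁ ↑ʳ b)) (∑-split n₁ (λ i → 𝟙[ g i ≟ m₁ ↑ʳ b ])) ⟩
    ∑[ i < n₁ ] 𝟙[ g (i ↑ˡ n₂) ≟ m₁ ↑ʳ b ] + ∑[ j < n₂ ] 𝟙[ g (n₁ ↑ʳ j) ≟ m₁ ↑ʳ b ]
      ≡⟨ cong₂ _+_ (∑-zero (λ i → 𝟙[ g (i ↑ˡ n₂) ≟ m₁ ↑ʳ b ]) other) (sum-cong-≗ same) ⟩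
    0 + ∑[ j < n₂ ] 𝟙[ g₂ j ≟ b ]
      ≡⟨ fibreSize≡∑ g₂ b ⟨
    fibreSize g₂ b ∎
    where
    g = g₁ ⊕ᶠ g₂
    same : ∀ j → 𝟙[ g (n₁ ↑ʳ j) ≟ m₁ ↑ʳ b ] ≡ 𝟙[ g₂ j ≟ b ]
    same j = 𝟙-⇔ (mk⇔ (↑ʳ-injective m₁ (g₂ j) b ∘ trans (sym (⊕ᶠ-↑ʳ g₁ g₂ j)))
                      (trans (⊕ᶠ-↑ʳ g₁ g₂ j) ∘ cong (m₁ ↑ʳ_)))
                 (g (n₁ ↑ʳ j) ≟ m₁ ↑ʳ b) (g₂ j ≟ b)
    other : ∀ i → 𝟙[ g (i ↑ˡ n₂) ≟ m₁ ↑ʳ b ] ≡ 0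
    other i = 𝟙-no (g (i ↑ˡ n₂) ≟ m₁ ↑ʳ b) (↑ˡ≢↑ʳ (g₁ i) b ∘ trans (sym (⊕ᶠ-↑ˡ g₁ g₂ i)))

  _⊔_ : (Ground n₁ → Fin m₁) → (Ground n₂ → Fin m₂) → Ground (n₁ + n₂) → Fin (m₁ + m₂)
  f₁ ⊔ f₂ = [ (f₁ ∘ inj₁) ⊕ᶠ (f₂ ∘ inj₁) , (f₁ ∘ inj₂) ⊕ᶠ (f₂ ∘ inj₂) ]′

  ⊔-blocks-↑ˡ : ∀ {a} {A : Set a} (F : ℕ → ℕ → A) f₁ f₂ b →
                F (upper (f₁ ⊔ f₂) (b ↑ˡ m₂)) (lower (f₁ ⊔ f₂) (b ↑ˡ m₂)) ≡ F (upper f₁ b) (lower f₁ b)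
  ⊔-blocks-↑ˡ F f₁ f₂ b = cong₂ F (fibreSize-⊕ᶠ-↑ˡ (f₁ ∘ inj₁) (f₂ ∘ inj₁) b)
                                  (fibreSize-⊕ᶠ-↑ˡ (f₁ ∘ inj₂) (f₂ ∘ inj₂) b)

  ⊔-blocks-↑ʳ : ∀ {a} {A : Set a} (F : ℕ → ℕ → A) f₁ f₂ b →
                F (upper (f₁ ⊔ f₂) (m₁ ↑ʳ b)) (lower (f₁ ⊔ f₂) (m₁ ↑ʳ b)) ≡ F (upper f₂ b) (lower f₂ b)
  ⊔-blocks-↑ʳ F f₁ f₂ b = cong₂ F (fibreSize-⊕ᶠ-↑ʳ (f₁ ∘ inj₁) (f₂ ∘ inj₁) b)
                                  (fibreSize-⊕ᶠ-↑ʳ (f₁ ∘ inj₂) (f₂ ∘ inj₂) b)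

  surj-⊔ : ∀ {f₁ f₂} → Surj f₁ → Surj f₂ → Surj (f₁ ⊔ f₂)
  surj-⊔ {f₁} {f₂} surj₁ surj₂ = ↑-elim (lift-↑ˡ ∘ surj₁) (lift-↑ʳ ∘ surj₂)
    where
    lift-↑ˡ : ∀ {b} → Σ (Ground n₁) (λ x → f₁ x ≡ b) →
              Σ (Ground (n₁ + n₂)) (λ x → (f₁ ⊔ f₂) x ≡ b ↑ˡ m₂)
    lift-↑ˡ (inj₁ i , refl) = inj₁ (i ↑ˡ n₂) , ⊕ᶠ-↑ˡ (f₁ ∘ inj₁) (f₂ ∘ inj₁) i
    lift-↑ˡ (inj₂ i , refl) = inj₂ (i ↑ˡ n₂) , ⊕ᶠ-↑ˡ (f₁ ∘ inj₂) (f₂ ∘ inj₂) i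
    lift-↑ʳ : ∀ {b} → Σ (Ground n₂) (λ x → f₂ x ≡ b) →
              Σ (Ground (n₁ + n₂)) (λ x → (f₁ ⊔ f₂) x ≡ m₁ ↑ʳ b)
    lift-↑ʳ (inj₁ i , refl) = inj₁ (n₁ ↑ʳ i) , ⊕ᶠ-↑ʳ (f₁ ∘ inj₁) (f₂ ∘ inj₁) i
    lift-↑ʳ (inj₂ i , refl) = inj₂ (n₁ ↑ʳ i) , ⊕ᶠ-↑ʳ (f₁ ∘ inj₂) (f₂ ∘ inj₂) i

  tonal-⊔ : ∀ {d f₁ f₂} → IsTonal d f₁ → IsTonal d f₂ → IsTonal d (f₁ ⊔ f₂)
  tonal-⊔ {d} {f₁} {f₂} tonal₁ tonal₂ =
    ↑-elim (λ b → subst (λ P → P) (sym (⊔-blocks-↑ˡ (_≡_[mod d ]) f₁ f₂ b)) (tonal₁ b))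
           (λ b → subst (λ P → P) (sym (⊔-blocks-↑ʳ (_≡_[mod d ]) f₁ f₂ b)) (tonal₂ b))

  Ψ-⊔ : ∀ d f₁ f₂ → Ψ d (f₁ ⊔ f₂) ≡ Ψ d f₁ ⊕ Ψ d f₂
  Ψ-⊔ d f₁ f₂ = lookup-extensionality λ k → begin
    lookup (Ψ d (f₁ ⊔ f₂)) k
      ≡⟨ trans (Ψ-lookup d (f₁ ⊔ f₂) k) (∑-split m₁ (λ b → 𝟙[ propCond? d (f₁ ⊔ f₂) k b ])) ⟩
    ∑[ b < m₁ ] 𝟙[ propCond? d (f₁ ⊔ f₂) k (b ↑ˡ m₂) ] +
    ∑[ b < m₂ ] 𝟙[ propCond? d (f₁ ⊔ f₂) k (m₁ ↑ʳ b) ]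
      ≡⟨ cong₂ _+_ (sum-cong-≗ (⊔-blocks-↑ˡ (λ U L → 𝟙[ propagating? d U L k ]) f₁ f₂))
                   (sum-cong-≗ (⊔-blocks-↑ʳ (λ U L → 𝟙[ propagating? d U L k ]) f₁ f₂)) ⟩
    ∑[ b < m₁ ] 𝟙[ propCond? d f₁ k b ] + ∑[ b < m₂ ] 𝟙[ propCond? d f₂ k b ]
      ≡⟨ trans (lookup-⊕ (Ψ d f₁) (Ψ d f₂) k) (cong₂ _+_ (Ψ-lookup d f₁ k) (Ψ-lookup d f₂ k)) ⟨
    lookup (Ψ d f₁ ⊕ Ψ d f₂) k ∎

image-⊕ : ∀ {d m n} {v w : Vec ℕ d} → InImageΨ d m v → InImageΨ d n w → InImageΨ d (m + n) (v ⊕ w)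
image-⊕ {d} (_ , f₁ , surj₁ , tonal₁ , refl) (_ , f₂ , surj₂ , tonal₂ , refl) =
  _ , f₁ ⊔ f₂ , surj-⊔ {f₁ = f₁} {f₂} surj₁ surj₂ , tonal-⊔ {f₁ = f₁} {f₂} tonal₁ tonal₂ ,
  Ψ-⊔ d f₁ f₂

image-0⃗ : ∀ {d} → InImageΨ d 0 0⃗
image-0⃗ = 0 , (λ { (inj₁ ()) ; (inj₂ ()) }) , (λ ()) , (λ ()) , refl

image-e : ∀ {d} (k : Fin (suc d)) → InImageΨ (suc d) (suc (toℕ k)) (e k)
image-e {d} k =
  1 , block , (λ { zero → inj₁ zero , refl }) , (λ { zero → tonal }) , lookup-extensionality signature
  where
  s : ℕ
  s = suc (toℕ k)
  block : Ground s → Fin 1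
  block _ = zero
  upper≡ : upper block zero ≡ s
  upper≡ = count-all (λ i → block (inj₁ i) ≟ zero) (λ _ → refl)
  lower≡ : lower block zero ≡ s
  lower≡ = count-all (λ i → block (inj₂ i) ≟ zero) (λ _ → refl)
  tonal : upper block zero ≡ lower block zero [mod suc d ]
  tonal = subst₂ (_≡_[mod suc d ]) (sym upper≡) (sym lower≡) (≼⇒≡[mod] {suc d} {s} (≼-reflexive refl))
  type⇔ : ∀ l → Propagating (suc d) s s l ⇔ k ≡ l
  type⇔ l = mk⇔ (λ p → toℕ-injective (sym (trans (to (propagating⇔ (toℕ k) (toℕ k) l) p) k%d≡k)))
                (λ k≡l → from (propagating⇔ (toℕ k) (toℕ k) l) (trans (cong toℕ (sym k≡l)) (sym k%d≡k)))
    where k%d≡k = m<n⇒m%n≡m (toℕ<n k)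
  signature : ∀ l → lookup (Ψ (suc d) block) l ≡ lookup (e k) l
  signature l = begin
    lookup (Ψ (suc d) block) l        ≡⟨ Ψ-lookup (suc d) block l ⟩
    𝟙[ propCond? (suc d) block l zero ] + 0
      ≡⟨ trans (+-identityʳ _) (cong₂ (λ U L → 𝟙[ propagating? (suc d) U L l ]) upper≡ lower≡) ⟩
    𝟙[ propagating? (suc d) s s l ]  ≡⟨ 𝟙-⇔ (type⇔ l) (propagating? (suc d) s s l) (k ≟ l) ⟩
    𝟙[ k ≟ l ]                       ≡⟨ lookup∘tabulate (λ l → 𝟙[ k ≟ l ]) l ⟨
    lookup (e k) l                   ∎

image-period : ∀ {d} → InImageΨ (suc d) (suc d) 0⃗
image-period {d} = 2 , halves , surj , tonal , lookup-extensionality signature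
  where
  halves : Ground (suc d) → Fin 2
  halves = [ (λ _ → zero) , (λ _ → suc zero) ]′
  surj : Surj halves
  surj zero       = inj₁ zero , refl
  surj (suc zero) = inj₂ zero , refl
  upper₀ : upper halves zero ≡ suc d
  upper₀ = count-all (λ i → halves (inj₁ i) ≟ zero) (λ _ → refl)
  lower₀ : lower halves zero ≡ 0
  lower₀ = count-none (λ i → halves (inj₂ i) ≟ zero) (λ _ ())
  upper₁ : upper halves (suc zero) ≡ 0
  upper₁ = count-none (λ i → halves (inj₁ i) ≟ suc zero) (λ _ ())
  lower₁ : lower halves (suc zero) ≡ suc d
  lower₁ = count-all (λ i → halves (inj₂ i) ≟ suc zero) (λ _ → refl)
  0≼d : 0 ≼[ suc d ] suc d
  0≼d = 1 , cong suc (sym (+-identityʳ d))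
  tonal : IsTonal (suc d) halves
  tonal zero       = subst₂ (_≡_[mod suc d ]) (sym upper₀) (sym lower₀) (≡[mod]-sym 0 (suc d) (≼⇒≡[mod] 0≼d))
  tonal (suc zero) = subst₂ (_≡_[mod suc d ]) (sym upper₁) (sym lower₁) (≼⇒≡[mod] 0≼d)
  π : ℕ → ℕ → Fin (suc d) → ℕ
  π U L l = 𝟙[ propagating? (suc d) U L l ]
  signature : ∀ l → lookup (Ψ (suc d) halves) l ≡ lookup 0⃗ l
  signature l = begin
    lookup (Ψ (suc d) halves) l
      ≡⟨ Ψ-lookup (suc d) halves l ⟩
    π (upper halves zero) (lower halves zero) l + (π (upper halves (suc zero)) (lower halves (suc zero)) l + 0)
      ≡⟨ cong₂ (λ x y → x + (y + 0)) (cong₂ (λ U L → π U L l) upper₀ lower₀)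
                                     (cong₂ (λ U L → π U L l) upper₁ lower₁) ⟩
    π (suc d) 0 l + (π 0 (suc d) l + 0)
      ≡⟨ cong₂ (λ x y → x + (y + 0)) (𝟙-no (propagating? (suc d) (suc d) 0 l) λ { (_ , () , _) })
                                     (𝟙-no (propagating? (suc d) 0 (suc d) l) λ { (() , _) }) ⟩
    0
      ≡⟨ lookup-0⃗ l ⟨
    lookup 0⃗ l ∎

weight≼⇒image : ∀ {d n} {v : Vec ℕ (suc d)} → weight v ≼[ suc d ] n → InImageΨ (suc d) n v
weight≼⇒image {d} = Generation.weight≼⇒P (InImageΨ (suc d)) image-0⃗ image-⊕ image-e image-period

proposition6p3 : (d : ℕ) → 0 < d → (n : ℕ) →
    (v : Vec ℕ d) → InImageΨ d n v ⇔ (v ∈I ne₁ d n)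
proposition6p3 (suc d) _ n v = mk⇔ (weight≼⇒∈I ∘ image⇒weight≼) (weight≼⇒image ∘ ∈I⇒weight≼)
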